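{- Let $H$ be a hypergraph and let $\{x_1,x_2,\ldots,x_\ell\}$ be the set of distinct edge sizes in $H$. Define $X=\left\{\frac{j}{x_i} \mid 1\leq i\leq \ell,\ 1\leq j\leq x_i-1\right\}$, assume $X$ is nonempty, and write its elements in increasing order as $y_1<y_2<\cdots<y_m$. Then each of the intervals $(0,y_1], (y_1,y_2],\ldots,(y_{m-1},y_m], (y_m,1)$ is a subset of some interval of the burning distribution of $H$ and a subset of some interval of the lazy burning distribution of $H$.
   Context: A hypergraph $H=(V(H),E(H))$ has a finite nonempty vertex set and a finite collection $E(H)$ of subsets of $V(H)$ called edges (parallel edges allowed). For a proportion $p\in(0,1)$, the proportion-based propagation rule is: if at the end of a round at least $\lceil p|e|\rceil$ vertices of an edge $e$ are on fire, then in the next round all vertices of $e$ catch fire; burned vertices stay burned. Burning game: let $F_0=\emptyset$ and $F_r$ be the set of burned vertices at the end of round $r$. In each round $r\geq 1$, simultaneously, vertices catch fire by propagation from $F_{r-1}$ (no propagation in round 1), and a player chooses a vertex $u_r\notin F_{r-1}$ (a source) and sets it on fire. A burning sequence is a sequence $(u_1,\ldots,u_k)$ of such sources after which every vertex is on fire at the end of round $k$; $b_p(H)$ is the minimum length of a burning sequence. Lazy game: $S\subseteq V(H)$ is a lazy burning set if, setting all of $S$ on fire at once and then repeatedly applying the propagation rule, every vertex eventually catches fire; $b_{L,p}(H)$ is the minimum size of a lazy burning set. With $n=|V(H)|$, the burning distribution is the partition of $(0,1)$ into the sets $P_j=\{p\in(0,1): b_p(H)=j\}$, and the lazy burning distribution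 into $Q_j=\{p\in(0,1): b_{L,p}(H)=j\}$, $j=1,\ldots,n$.
   Formalization: The proportion p ranges only over the rationals in (0,1), so both the burning distribution and the lazy burning distribution of H are considered at rational proportions. -}

module Defs where

open import Data.Nat as ℕ using (ℕ; zero; suc; _∸_)
open import Data.Integer as ℤ using (ℤ; +_)
open import Data.Rational as ℚ using (ℚ; 0ℚ; 1ℚ; _/_; _*_; ceiling)
open import Data.Fin as Fin using (Fin)
open import Data.Empty using () renaming (⊥ to Empty)
open import Data.Fin.Subset using (Subset; _∩_; _∪_; ⁅_⁆; _∉_; ∣_∣; ⊤)
open import Data.List using (List; []; _∷_; foldr; concatMap; map; upTo; length)
open import Data.Vec using (Vec; []; _∷_)
open import Data.Product using (_×_; Σ; ∃)
open import Data.Unit using () renaming (⊤ to Unit)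
open import Data.Bool using (if_then_else_)
open import Relation.Nullary.Decidable using (⌊_⌋)
open import Relation.Binary.PropositionalEquality using (_≡_)

-- A hypergraph on the vertex set Fin n: a finite list of edges (subsets
-- of the vertex set); repeated entries are parallel edges.
Hypergraph : ℕ → Set
Hypergraph n = List (Subset n)

threshold : ∀ {n} → ℚ → Subset n → ℤ
threshold p e = ceiling (p * (+ ∣ e ∣ / 1))

spread : ∀ {n} → Hypergraph n → ℚ → Subset n → Subset n
spread H p F =
  foldr (λ e acc → if ⌊ threshold p e ℤ.≤? + ∣ e ∩ F ∣ ⌋ then acc ∪ e else acc) F H

-- Given the burned set F = F_{r-1} at the end of a round, the remaining
-- sources u_r, u_{r+1}, ... are legal: each source is not yet burned.
ValidFrom : ∀ {n} → Hypergraph n → ℚ → Subset n → List (Fin n) → Set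
ValidFrom H p F []       = Unit
ValidFrom H p F (u ∷ us) = (u ∉ F) × ValidFrom H p (spread H p F ∪ ⁅ u ⁆) us

finalFrom : ∀ {n} → Hypergraph n → ℚ → Subset n → List (Fin n) → Subset n
finalFrom H p F []       = F
finalFrom H p F (u ∷ us) = finalFrom H p (spread H p F ∪ ⁅ u ⁆) us

-- (u_1,...,u_k) is a burning sequence. Round 1: no propagation, F_1 = {u_1}.
IsBurningSeq : ∀ {n} → Hypergraph n → ℚ → List (Fin n) → Set
IsBurningSeq H p []       = Empty
IsBurningSeq H p (u ∷ us) = ValidFrom H p ⁅ u ⁆ us × finalFrom H p ⁅ u ⁆ us ≡ ⊤

BurningNumber : ∀ {n} → Hypergraph n → ℚ → ℕ → Set
BurningNumber H p j =
  (Σ (List _) λ us → IsBurningSeq H p us × length us ≡ j) ×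
  (∀ us → IsBurningSeq H p us → j ℕ.≤ length us)

spreadIter : ∀ {n} → Hypergraph n → ℚ → ℕ → Subset n → Subset n
spreadIter H p zero    S = S
spreadIter H p (suc t) S = spreadIter H p t (spread H p S)

IsLazyBurningSet : ∀ {n} → Hypergraph n → ℚ → Subset n → Set
IsLazyBurningSet H p S = ∃ λ t → spreadIter H p t S ≡ ⊤

LazyBurningNumber : ∀ {n} → Hypergraph n → ℚ → ℕ → Set
LazyBurningNumber H p j =
  (Σ (Subset _) λ S → IsLazyBurningSet H p S × ∣ S ∣ ≡ j) ×
  (∀ S → IsLazyBurningSet H p S → j ℕ.≤ ∣ S ∣)

-- the fraction j / x (x ≥ 1 whenever used)
frac : ℕ → ℕ → ℚ
frac j zero    = 0ℚ
frac j (suc x) = + j / suc x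

fracsOf : ℕ → List ℚ
fracsOf x = map (λ j → frac (suc j) x) (upTo (x ∸ 1))

Xset : ∀ {n} → Hypergraph n → List ℚ
Xset H = concatMap (λ e → fracsOf ∣ e ∣) H

-- Given lo and y_1 < ... < y_m, interval number i (i = 0..m):
-- (lo, y_1], (y_1, y_2], ..., (y_{m-1}, y_m], (y_m, 1).
InIntervalFrom : ∀ {m} → ℚ → Vec ℚ m → Fin (suc m) → ℚ → Set
InIntervalFrom lo []       Fin.zero    p = (lo ℚ.< p) × (p ℚ.< 1ℚ)
InIntervalFrom lo (y ∷ ys) Fin.zero    p = (lo ℚ.< p) × (p ℚ.≤ y)
InIntervalFrom lo (y ∷ ys) (Fin.suc i) p = InIntervalFrom y ys i p

InInterval : ∀ {m} → Vec ℚ m → Fin (suc m) → ℚ → Set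
InInterval ys = InIntervalFrom 0ℚ ys

-- For 0 < p < 1 the rule "⌈p|e|⌉ vertices of e are on fire" only depends on which of
-- the inequalities p ≤ j/|e| (1 ≤ j < |e|) hold: ⌈p|e|⌉ ≤ k iff p ≤ k/|e|, which always
-- holds for k ≥ |e| and never for k = 0.  Two proportions in the same interval lie on
-- the same side of every element of X, so they give the same propagation step, hence
-- the same games and the same burning and lazy burning numbers.  Both numbers exist
-- because a greedy sequence burns everything and every lazy burning set burns
-- everything within |V(H)| rounds.
module Submission where

open import Defs
open import Data.Nat using (ℕ; suc)
open import Data.Rational using (ℚ)
open import Data.Fin using (Fin; _<_)
open import Data.Vec using (Vec; lookup)
open import Data.List.Membership.Propositional using (_∈_)
open import Data.Product using (_×_; ∃)
open import Relation.Binary.PropositionalEquality using (_≡_)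
import Data.Rational

open import Data.Bool using (Bool; true; false; if_then_else_)
import Data.Bool.Properties as Bool
open import Data.Empty using (⊥-elim)
import Data.Fin as Fin
import Data.Fin.Properties as Fin
open import Data.Fin.Subset using (Subset; _⊆_; _⊂_; _∪_; _∩_; ⁅_⁆; ⊤; ∣_∣)
  renaming (_∈_ to _∈ₛ_; _∉_ to _∉ₛ_)
import Data.Fin.Subset.Properties as Subset
open import Data.Integer as ℤ using (+_; -_)
import Data.Integer.DivMod as ℤ
import Data.Integer.Properties as ℤ
open import Data.List using (List; []; _∷_; foldr; length; allFin)
open import Data.List.Membership.Propositional using (find; lose)
open import Data.List.Membership.Propositional.Properties
  using (∈-allFin; ∈-concatMap⁺; ∈-concatMap⁻; ∈-map⁺; ∈-map⁻; ∈-upTo⁺; ∈-upTo⁻)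
open import Data.List.Relation.Unary.Any using (here; there)
open import Data.Nat as ℕ using (zero; _+_)
import Data.Nat.Coprimality as Coprime
open import Data.Nat.GeneralisedArithmetic using (iterate)
import Data.Nat.Properties as ℕ
open import Data.Product using (_,_; ∃-syntax; proj₁; proj₂)
open import Data.Rational as ℚ using (mkℚ; ↥_; ↧_; floor; ceiling; _/_)
import Data.Rational.Properties as ℚ
open import Data.Rational.Unnormalised as ℚᵘ using (mkℚᵘ; *≤*; *<*)
import Data.Rational.Unnormalised.Properties as ℚᵘ
open import Data.Sum using (_⊎_; inj₁; inj₂; [_,_]′)
open import Data.Unit using (tt)
open import Data.Vec using ([]; _∷_)
import Data.Vec.Properties as Vec
open import Function using (_∘_; id; const)
open import Function.Bundles using (_⇔_; mk⇔; module Equivalence)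
open import Function.Construct.Composition using (_⇔-∘_)
open import Function.Construct.Symmetry using (⇔-sym)
open import Relation.Binary.PropositionalEquality
  using (refl; sym; trans; cong; cong₂; subst; subst₂; module ≡-Reasoning)
open import Relation.Nullary using (Dec; yes; no; ¬_; contradiction)
open import Relation.Nullary.Decidable using (isYes; _×-dec_; ¬?; decidable-stable)
open import Relation.Unary using (Decidable)

open Equivalence using (to; from)

-- Thresholds

floor-greatest : ∀ r m → m ℤ.≤ floor r ⇔ m ℤ.* ↧ r ℤ.≤ ↥ r
floor-greatest (mkℚ n d _) m = mk⇔ to′ from′
  where
  ⌊r⌋≡ : n ℤ./ + suc d ≡ n ℤ./ℕ suc d
  ⌊r⌋≡ = ℤ.div-pos-is-/ℕ n (suc d)
  to′ : m ℤ.≤ n ℤ./ + suc d → m ℤ.* + suc d ℤ.≤ n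
  to′ m≤ = ℤ.≤-trans (ℤ.*-monoʳ-≤-nonNeg (+ suc d) (subst (m ℤ.≤_) ⌊r⌋≡ m≤)) (ℤ.[n/ℕd]*d≤n n (suc d))
  from′ : m ℤ.* + suc d ℤ.≤ n → m ℤ.≤ n ℤ./ + suc d
  from′ md≤n = subst (m ℤ.≤_) (trans (ℤ.pred-suc _) (sym ⌊r⌋≡)) (ℤ.i<j⇒i≤pred[j]
    (ℤ.*-cancelʳ-<-nonNeg {j = ℤ.suc (n ℤ./ℕ suc d)} (+ suc d) (ℤ.≤-<-trans md≤n (ℤ.n<s[n/ℕd]*d n (suc d)))))

ceiling-least : ∀ r k → ceiling r ℤ.≤ k ⇔ ↥ r ℤ.≤ k ℤ.* ↧ r
ceiling-least r@record{} k = mk⇔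
  (λ ⌈r⌉≤k → ℤ.neg-cancel-≤ (subst₂ ℤ._≤_ -k↧r≡ (ℚ.↥-neg r) (to (floor-greatest (ℚ.- r) (- k)) (neg-swap ⌈r⌉≤k))))
  (λ ↥r≤ → neg-swap (from (floor-greatest (ℚ.- r) (- k)) (subst₂ ℤ._≤_ (sym -k↧r≡) (sym (ℚ.↥-neg r)) (ℤ.neg-mono-≤ ↥r≤))))
  where
  neg-swap : ∀ {a b} → - a ℤ.≤ b → - b ℤ.≤ a
  neg-swap {a} -a≤b = subst (_ ℤ.≤_) (ℤ.neg-involutive a) (ℤ.neg-mono-≤ -a≤b)
  -k↧r≡ : (- k) ℤ.* ↧ (ℚ.- r) ≡ - (k ℤ.* ↧ r)
  -k↧r≡ = trans (cong ((- k) ℤ.*_) (ℚ.↧-neg r)) (sym (ℤ.neg-distribˡ-* k (↧ r)))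

≤ᵘ-integer⇔ : ∀ a k → a ℚᵘ.≤ mkℚᵘ k 0 ⇔ ℚᵘ.↥ a ℤ.≤ k ℤ.* ℚᵘ.↧ a
≤ᵘ-integer⇔ a k = mk⇔
  (λ { (*≤* a≤k) → subst (ℤ._≤ k ℤ.* ℚᵘ.↧ a) (ℤ.*-identityʳ (ℚᵘ.↥ a)) a≤k })
  (λ a≤k → *≤* (subst (ℤ._≤ k ℤ.* ℚᵘ.↧ a) (sym (ℤ.*-identityʳ (ℚᵘ.↥ a))) a≤k))

≤ᵘ-respˡ-≃⇔ : ∀ {a b c} → a ℚᵘ.≃ b → a ℚᵘ.≤ c ⇔ b ℚᵘ.≤ c
≤ᵘ-respˡ-≃⇔ a≃b = mk⇔ (ℚᵘ.≤-respˡ-≃ a≃b) (ℚᵘ.≤-respˡ-≃ (ℚᵘ.≃-sym a≃b))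

≤ᵘ-respʳ-≃⇔ : ∀ {a b c} → a ℚᵘ.≃ b → c ℚᵘ.≤ a ⇔ c ℚᵘ.≤ b
≤ᵘ-respʳ-≃⇔ a≃b = mk⇔ (ℚᵘ.≤-respʳ-≃ a≃b) (ℚᵘ.≤-respʳ-≃ (ℚᵘ.≃-sym a≃b))

↥≤*↧⇔≤ᵘ : ∀ r k → ↥ r ℤ.≤ k ℤ.* ↧ r ⇔ ℚ.toℚᵘ r ℚᵘ.≤ mkℚᵘ k 0
↥≤*↧⇔≤ᵘ r@record{} k = ⇔-sym (≤ᵘ-integer⇔ (ℚ.toℚᵘ r) k)

-- r ≤ k may be tested on the unreduced fraction i / d instead of on r = i / d.
↥≤*↧-/⇔ : ∀ i d k → ↥ (i / suc d) ℤ.≤ k ℤ.* ↧ (i / suc d) ⇔ i ℤ.≤ k ℤ.* + suc d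
↥≤*↧-/⇔ i d k =
  ≤ᵘ-integer⇔ (mkℚᵘ i d) k ⇔-∘ (≤ᵘ-respˡ-≃⇔ (ℚ.toℚᵘ-fromℚᵘ (mkℚᵘ i d)) ⇔-∘ ↥≤*↧⇔≤ᵘ (i / suc d) k)

_·_≤_ : ℚ → ℕ → ℕ → Set
p · s ≤ k = ↥ p ℤ.* + s ℤ.≤ + k ℤ.* ↧ p

≤/⇔· : ∀ p k s → p ℚ.≤ + k / suc s ⇔ p · suc s ≤ k
≤/⇔· p@record{} k s = mk⇔ (λ { (*≤* h) → h }) *≤*
  ⇔-∘ (≤ᵘ-respʳ-≃⇔ (ℚ.toℚᵘ-fromℚᵘ (mkℚᵘ (+ k) s)) ⇔-∘ mk⇔ ℚ.toℚᵘ-mono-≤ ℚ.toℚᵘ-cancel-≤)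

coprime-1 : ∀ s → Coprime.Coprime s 1
coprime-1 s = Coprime.sym (Coprime.1-coprimeTo s)

+s/1≡mkℚ : ∀ s → + s / 1 ≡ mkℚ (+ s) 0 (coprime-1 s)
+s/1≡mkℚ s = ℚ.normalize-coprime (coprime-1 s)

threshold-≤⇔ : ∀ {n} p (e : Subset n) k → threshold p e ℤ.≤ + k ⇔ p · ∣ e ∣ ≤ k
threshold-≤⇔ p@(mkℚ a b _) e k rewrite +s/1≡mkℚ ∣ e ∣ =
  -- p ℚ.* (+ s / 1) unfolds to (a ℤ.* + s) / (suc b ℕ.* 1)
  subst (λ d → ceiling (p ℚ.* mkℚ (+ ∣ e ∣) 0 (coprime-1 ∣ e ∣)) ℤ.≤ + k ⇔ a ℤ.* + ∣ e ∣ ℤ.≤ + k ℤ.* + suc d)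
    (ℕ.*-identityʳ b)
    (↥≤*↧-/⇔ (a ℤ.* + ∣ e ∣) (b ℕ.* 1) (+ k) ⇔-∘ ceiling-least ((a ℤ.* + ∣ e ∣) / suc (b ℕ.* 1)) (+ k))

↥<↧ : ∀ {p} → p ℚ.< ℚ.1ℚ → ↥ p ℤ.< ↧ p
↥<↧ {p@record{}} p<1 with ℚ.toℚᵘ-mono-< p<1
... | *<* h = subst₂ ℤ._<_ (ℤ.*-identityʳ (↥ p)) (ℤ.*-identityˡ (↧ p)) h

0<↥ : ∀ {p} → ℚ.0ℚ ℚ.< p → + 0 ℤ.< ↥ p
0<↥ {p@record{}} 0<p with ℚ.toℚᵘ-mono-< 0<p
... | *<* h = subst (+ 0 ℤ.<_) (ℤ.*-identityʳ (↥ p)) h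

·≤-of-≤ : ∀ {p s k} → p ℚ.< ℚ.1ℚ → s ℕ.≤ k → p · s ≤ k
·≤-of-≤ {p@record{}} {s} {k} p<1 s≤k = begin
  ↥ p ℤ.* + s ≤⟨ ℤ.*-monoʳ-≤-nonNeg (+ s) (ℤ.<⇒≤ (↥<↧ p<1)) ⟩
  ↧ p ℤ.* + s ≤⟨ ℤ.*-monoˡ-≤-nonNeg (↧ p) (ℤ.+≤+ s≤k) ⟩
  ↧ p ℤ.* + k ≡⟨ ℤ.*-comm (↧ p) (+ k) ⟩
  + k ℤ.* ↧ p ∎
  where open ℤ.≤-Reasoning

·≰0 : ∀ {p} s → ℚ.0ℚ ℚ.< p → ¬ p · suc s ≤ 0
·≰0 s 0<p = ℤ.<⇒≱ (ℤ.*-monoʳ-<-pos (+ suc s) (0<↥ 0<p))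

Proportion : ℚ → Set
Proportion p = ℚ.0ℚ ℚ.< p × p ℚ.< ℚ.1ℚ

SameSide : List ℚ → ℚ → ℚ → Set
SameSide X p p′ = ∀ q → q ∈ X → p ℚ.≤ q ⇔ p′ ℚ.≤ q

∈-fracsOf : ∀ {j s} → j ℕ.< s → + suc j / suc s ∈ fracsOf (suc s)
∈-fracsOf j<s = ∈-map⁺ _ (∈-upTo⁺ j<s)

frac-Proportion : ∀ {j s} → j ℕ.< s → Proportion (+ suc j / suc s)
frac-Proportion {j} {s} j<s = ℚ.positive⁻¹ _ {{ℚ.normalize-pos (suc j) (suc s)}} , ℚ.≰⇒> 1≰q
  where
  1≰q : ¬ ℚ.1ℚ ℚ.≤ + suc j / suc s
  1≰q 1≤q = ℕ.<⇒≱ (ℕ.s≤s j<s) (ℤ.drop‿+≤+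
    (subst₂ ℤ._≤_ (ℤ.*-identityˡ (+ suc s)) (ℤ.*-identityʳ (+ suc j)) (to (≤/⇔· ℚ.1ℚ (suc j) s) 1≤q)))

fracsOf-Proportion : ∀ {s q} → q ∈ fracsOf s → Proportion q
fracsOf-Proportion {suc s} q∈ with ∈-map⁻ _ q∈
... | j , j∈ , refl = frac-Proportion (∈-upTo⁻ j∈)

fracsOf-⊆-Xset : ∀ {n} {H : Hypergraph n} {e q} → e ∈ H → q ∈ fracsOf ∣ e ∣ → q ∈ Xset H
fracsOf-⊆-Xset {H = H} e∈H q∈ = ∈-concatMap⁺ (λ e → fracsOf ∣ e ∣) {xs = H} (lose e∈H q∈)

Xset-Proportion : ∀ {n} (H : Hypergraph n) {q} → q ∈ Xset H → Proportion q
Xset-Proportion H q∈ with find (∈-concatMap⁻ (λ e → fracsOf ∣ e ∣) {xs = H} q∈)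
... | e , _ , q∈fracs = fracsOf-Proportion {∣ e ∣} q∈fracs

·≤-transfer : ∀ {p p′} s k → ℚ.0ℚ ℚ.< p → p′ ℚ.< ℚ.1ℚ →
  (∀ q → q ∈ fracsOf s → p ℚ.≤ q → p′ ℚ.≤ q) → p · s ≤ k → p′ · s ≤ k
·≤-transfer s k 0<p p′<1 below ps≤k with s ℕ.≤? k
... | yes s≤k = ·≤-of-≤ p′<1 s≤k
·≤-transfer zero    k       0<p p′<1 below ps≤k | no 0≰k = ⊥-elim (0≰k ℕ.z≤n)
·≤-transfer (suc s) zero    0<p p′<1 below ps≤0 | no _   = ⊥-elim (·≰0 s 0<p ps≤0)
·≤-transfer {p} {p′} (suc s) (suc k) 0<p p′<1 below ps≤k | no s≰k =
  to (≤/⇔· p′ (suc k) s) (below _ (∈-fracsOf (ℕ.s≤s⁻¹ (ℕ.≰⇒> s≰k))) (from (≤/⇔· p (suc k) s) ps≤k))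

threshold-≤-transfer : ∀ {n p p′} (e : Subset n) k → Proportion p → Proportion p′ →
  SameSide (fracsOf ∣ e ∣) p p′ → threshold p e ℤ.≤ + k → threshold p′ e ℤ.≤ + k
threshold-≤-transfer {p = p} {p′} e k (0<p , _) (_ , p′<1) same =
  from (threshold-≤⇔ p′ e k) ∘ ·≤-transfer ∣ e ∣ k 0<p p′<1 (λ q q∈ → to (same q q∈)) ∘ to (threshold-≤⇔ p e k)

isYes-⇔ : ∀ {A B : Set} → A ⇔ B → (a? : Dec A) (b? : Dec B) → isYes a? ≡ isYes b?
isYes-⇔ A⇔B (yes _) (yes _) = refl
isYes-⇔ A⇔B (no _)  (no _)  = refl
isYes-⇔ A⇔B (yes a) (no ¬b) = ⊥-elim (¬b (to A⇔B a))
isYes-⇔ A⇔B (no ¬a) (yes b) = ⊥-elim (¬a (from A⇔B b))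

spread-cong : ∀ {n} (H : Hypergraph n) {p p′} → Proportion p → Proportion p′ →
  (∀ e → e ∈ H → SameSide (fracsOf ∣ e ∣) p p′) → ∀ F → spread H p F ≡ spread H p′ F
spread-cong []      p∈ p′∈ same F = refl
spread-cong (e ∷ H) {p} {p′} p∈ p′∈ same F =
  cong₂ (λ fires G → if fires then G ∪ e else G)
    (isYes-⇔ fires⇔ (_ ℤ.≤? _) (_ ℤ.≤? _)) (spread-cong H p∈ p′∈ (λ e′ → same e′ ∘ there) F)
  where
  same-e : SameSide (fracsOf ∣ e ∣) p p′
  same-e = same e (here refl)
  fires⇔ : threshold p e ℤ.≤ + ∣ e ∩ F ∣ ⇔ threshold p′ e ℤ.≤ + ∣ e ∩ F ∣
  fires⇔ = mk⇔ (threshold-≤-transfer e _ p∈ p′∈ same-e)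
               (threshold-≤-transfer e _ p′∈ p∈ (λ q q∈ → ⇔-sym (same-e q q∈)))

-- Intervals

record Increasing {m} (ys : Vec ℚ m) : Set where
  constructor increasing
  field lookup-< : ∀ (i j : Fin m) → i Fin.< j → lookup ys i ℚ.< lookup ys j

module _ {m y} {ys : Vec ℚ m} (inc : Increasing (y ∷ ys)) where
  open Increasing inc

  Increasing-tail : Increasing ys
  Increasing-tail = increasing λ i j i<j → lookup-< (Fin.suc i) (Fin.suc j) (ℕ.s≤s i<j)

  Increasing-head : ∀ t → y ℚ.< lookup ys t
  Increasing-head t = lookup-< Fin.zero (Fin.suc t) (ℕ.s≤s ℕ.z≤n)

InIntervalFrom-lower : ∀ {m lo} {ys : Vec ℚ m} → Increasing ys → (∀ t → lo ℚ.< lookup ys t) →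
  ∀ {i p} → InIntervalFrom lo ys i p → lo ℚ.< p
InIntervalFrom-lower {ys = []}     inc lo< {Fin.zero}  (lo<p , _) = lo<p
InIntervalFrom-lower {ys = y ∷ ys} inc lo< {Fin.zero}  (lo<p , _) = lo<p
InIntervalFrom-lower {ys = y ∷ ys} inc lo< {Fin.suc i} p∈ =
  ℚ.<-trans (lo< Fin.zero) (InIntervalFrom-lower (Increasing-tail inc) (Increasing-head inc) p∈)

InIntervalFrom-upper : ∀ {m lo} {ys : Vec ℚ m} → (∀ t → lookup ys t ℚ.< ℚ.1ℚ) →
  ∀ {i p} → InIntervalFrom lo ys i p → p ℚ.< ℚ.1ℚ
InIntervalFrom-upper {ys = []}     <1 {Fin.zero}  (_ , p<1) = p<1
InIntervalFrom-upper {ys = y ∷ ys} <1 {Fin.zero}  (_ , p≤y) = ℚ.≤-<-trans p≤y (<1 Fin.zero)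
InIntervalFrom-upper {ys = y ∷ ys} <1 {Fin.suc i} p∈ = InIntervalFrom-upper {ys = ys} (λ t → <1 (Fin.suc t)) p∈

InIntervalFrom-nonempty : ∀ {m lo} {ys : Vec ℚ m} → Increasing ys → (∀ t → lo ℚ.< lookup ys t) →
  (∀ t → lookup ys t ℚ.< ℚ.1ℚ) → lo ℚ.< ℚ.1ℚ → ∀ i → ∃ (InIntervalFrom lo ys i)
InIntervalFrom-nonempty {ys = []}     inc lo< <1 lo<1 Fin.zero    = ℚ.<-dense lo<1
InIntervalFrom-nonempty {ys = y ∷ ys} inc lo< <1 lo<1 Fin.zero    = y , lo< Fin.zero , ℚ.≤-refl
InIntervalFrom-nonempty {ys = y ∷ ys} inc lo< <1 lo<1 (Fin.suc i) =
  InIntervalFrom-nonempty (Increasing-tail inc) (Increasing-head inc) (λ t → <1 (Fin.suc t)) (<1 Fin.zero) i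

InIntervalFrom-≤-lookup⇔ : ∀ {m lo} {ys : Vec ℚ m} → Increasing ys → ∀ {i p} → InIntervalFrom lo ys i p →
  ∀ t → p ℚ.≤ lookup ys t ⇔ Fin.toℕ i ℕ.≤ Fin.toℕ t
InIntervalFrom-≤-lookup⇔ {ys = y ∷ ys} inc {Fin.zero} (_ , p≤y) Fin.zero = mk⇔ (const ℕ.z≤n) (const p≤y)
InIntervalFrom-≤-lookup⇔ {ys = y ∷ ys} inc {Fin.zero} (_ , p≤y) (Fin.suc t) =
  mk⇔ (const ℕ.z≤n) (const (ℚ.≤-trans p≤y (ℚ.<⇒≤ (Increasing-head inc t))))
InIntervalFrom-≤-lookup⇔ {ys = y ∷ ys} inc {Fin.suc i} {p} p∈ Fin.zero =
  mk⇔ (λ p≤y → ⊥-elim (ℚ.<-irrefl refl (ℚ.<-≤-trans y<p p≤y))) (λ ())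
  where
  y<p : y ℚ.< p
  y<p = InIntervalFrom-lower (Increasing-tail inc) (Increasing-head inc) p∈
InIntervalFrom-≤-lookup⇔ {ys = y ∷ ys} inc {Fin.suc i} p∈ (Fin.suc t) =
  mk⇔ (ℕ.s≤s ∘ to (InIntervalFrom-≤-lookup⇔ (Increasing-tail inc) p∈ t)) (from (InIntervalFrom-≤-lookup⇔ (Increasing-tail inc) p∈ t) ∘ ℕ.s≤s⁻¹)

-- Burning numbers exist

module _ {P : ℕ → Set} (P? : Decidable P) where

  private
    Least : ℕ → Set
    Least j = P j × (∀ k → P k → j ℕ.≤ k)

    none-below-or-least : ∀ n → (∀ k → k ℕ.< n → ¬ P k) ⊎ ∃ Least
    none-below-or-least zero = inj₁ λ _ ()
    none-below-or-least (suc n) with none-below-or-least n | P? n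
    ... | inj₂ least | _      = inj₂ least
    ... | inj₁ none  | yes Pn = inj₂ (n , Pn , λ k Pk → ℕ.≮⇒≥ λ k<n → none k k<n Pk)
    ... | inj₁ none  | no ¬Pn = inj₁ λ k k<1+n → [ none k , (λ { refl → ¬Pn }) ]′ (ℕ.m<1+n⇒m<n∨m≡n k<1+n)

  least-witness : ∀ {n} → P n → ∃[ j ] P j × (∀ k → P k → j ℕ.≤ k)
  least-witness {n} Pn with none-below-or-least (suc n)
  ... | inj₁ none  = contradiction Pn (none n ℕ.≤-refl)
  ... | inj₂ least = least

_≟ₛ_ : ∀ {n} (A B : Subset n) → Dec (A ≡ B)
_≟ₛ_ = Vec.≡-dec Bool._≟_

⊆∧⊄⇒≡ : ∀ {n} {A B : Subset n} → A ⊆ B → ¬ A ⊂ B → A ≡ B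
⊆∧⊄⇒≡ {A = A} A⊆B A⊄B =
  Subset.⊆-antisym A⊆B λ {x} x∈B → decidable-stable (x Subset.∈? A) λ x∉A → A⊄B (A⊆B , x , x∈B , x∉A)

foldr-∪-⊇ : ∀ {n} (fires : Subset n → Bool) F H → F ⊆ foldr (λ e G → if fires e then G ∪ e else G) F H
foldr-∪-⊇ fires F []      x∈F = x∈F
foldr-∪-⊇ fires F (e ∷ H) x∈F with fires e
... | true  = Subset.p⊆p∪q e (foldr-∪-⊇ fires F H x∈F)
... | false = foldr-∪-⊇ fires F H x∈F

spread-⊇ : ∀ {n} (H : Hypergraph n) p F → F ⊆ spread H p F
spread-⊇ H p F = foldr-∪-⊇ (λ e → isYes (threshold p e ℤ.≤? + ∣ e ∩ F ∣)) F H

any-ofLength? : ∀ {N} {P : List (Fin N) → Set} → Decidable P → ∀ j → Dec (∃[ us ] length us ≡ j × P us)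
any-ofLength? P? zero with P? []
... | yes P[] = yes ([] , refl , P[])
... | no ¬P[] = no λ { ([] , _ , P[]) → ¬P[] P[] }
any-ofLength? P? (suc j) with Fin.any? (λ u → any-ofLength? (λ us → P? (u ∷ us)) j)
... | yes (u , us , refl , Pu∷us) = yes (u ∷ us , refl , Pu∷us)
... | no ¬∃ = no λ { (u ∷ us , refl , Pu∷us) → ¬∃ (u , us , refl , Pu∷us) }

module _ {n} (f : Subset n → Subset n) (f-⊇ : ∀ S → S ⊆ f S) where

  Fixed : Subset n → Set
  Fixed G = f G ≡ G

  iterate-+ : ∀ S a b → iterate f S (a + b) ≡ iterate f (iterate f S a) b
  iterate-+ S zero    b = refl
  iterate-+ S (suc a) b = iterate-+ (f S) a b

  iterate-suc : ∀ S t → iterate f S (suc t) ≡ f (iterate f S t)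
  iterate-suc S zero    = refl
  iterate-suc S (suc t) = iterate-suc (f S) t

  iterate-⊇ : ∀ S t → S ⊆ iterate f S t
  iterate-⊇ S zero    x∈S = x∈S
  iterate-⊇ S (suc t) x∈S = iterate-⊇ (f S) t (f-⊇ S x∈S)

  iterate-Fixed : ∀ {G} → Fixed G → ∀ t → iterate f G t ≡ G
  iterate-Fixed fixed zero    = refl
  iterate-Fixed fixed (suc t) rewrite fixed = iterate-Fixed fixed t

  ⊤-Fixed : Fixed ⊤
  ⊤-Fixed = Subset.⊆-antisym Subset.⊆⊤ (f-⊇ ⊤)

  Fixed-step : ∀ S k → Fixed (iterate f S k) → Fixed (iterate f S (suc k))
  Fixed-step S k fixed rewrite iterate-suc S k | fixed = fixed

  Fixed-or-growing : ∀ S k → Fixed (iterate f S k) ⊎ k ℕ.≤ ∣ iterate f S k ∣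
  Fixed-or-growing S zero = inj₂ ℕ.z≤n
  Fixed-or-growing S (suc k) with Fixed-or-growing S k | iterate f S k Subset.⊂? f (iterate f S k)
  ... | inj₁ fixed | _      = inj₁ (Fixed-step S k fixed)
  ... | inj₂ _     | no G⊄  = inj₁ (Fixed-step S k (sym (⊆∧⊄⇒≡ (f-⊇ _) G⊄)))
  ... | inj₂ k≤∣G∣ | yes G⊂ = inj₂ (subst (λ G → suc k ℕ.≤ ∣ G ∣) (sym (iterate-suc S k))
                                       (ℕ.≤-<-trans k≤∣G∣ (Subset.p⊂q⇒∣p∣<∣q∣ G⊂)))

  iterate-stabilises : ∀ S → Fixed (iterate f S n)
  iterate-stabilises S with Fixed-or-growing S n
  ... | inj₁ fixed = fixed
  ... | inj₂ n≤∣G∣ =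
    subst Fixed (sym (Subset.∣p∣≡n⇒p≡⊤ (ℕ.≤-antisym (Subset.∣p∣≤n (iterate f S n)) n≤∣G∣))) ⊤-Fixed

  iterate-saturates : ∀ {S} t → iterate f S t ≡ ⊤ → iterate f S n ≡ ⊤
  iterate-saturates {S} t burnt = Subset.⊆-antisym Subset.⊆⊤ λ x∈⊤ →
    subst (_ ∈ₛ_) later≡now (iterate-⊇ _ n (subst (_ ∈ₛ_) (sym burnt) x∈⊤))
    where
    later≡now : iterate f (iterate f S t) n ≡ iterate f S n
    later≡now = begin
      iterate f (iterate f S t) n ≡⟨ iterate-+ S t n ⟨
      iterate f S (t + n)         ≡⟨ cong (iterate f S) (ℕ.+-comm t n) ⟩
      iterate f S (n + t)         ≡⟨ iterate-+ S n t ⟩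
      iterate f (iterate f S n) t ≡⟨ iterate-Fixed (iterate-stabilises S) t ⟩
      iterate f S n               ∎
      where open ≡-Reasoning

module _ {n} (H : Hypergraph n) (p : ℚ) where

  ValidFrom? : ∀ F us → Dec (ValidFrom H p F us)
  ValidFrom? F []       = yes tt
  ValidFrom? F (u ∷ us) = ¬? (u Subset.∈? F) ×-dec ValidFrom? (spread H p F ∪ ⁅ u ⁆) us

  IsBurningSeq? : ∀ us → Dec (IsBurningSeq H p us)
  IsBurningSeq? []       = no λ ()
  IsBurningSeq? (u ∷ us) = ValidFrom? ⁅ u ⁆ us ×-dec (finalFrom H p ⁅ u ⁆ us ≟ₛ ⊤)

  finalFrom-⊇ : ∀ F us → F ⊆ finalFrom H p F us
  finalFrom-⊇ F []       x∈F = x∈F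
  finalFrom-⊇ F (u ∷ us) x∈F = finalFrom-⊇ _ us (Subset.p⊆p∪q ⁅ u ⁆ (spread-⊇ H p F x∈F))

  greedy : Subset n → List (Fin n) → List (Fin n)
  greedy F []       = []
  greedy F (v ∷ vs) with v Subset.∈? F
  ... | yes _ = greedy F vs
  ... | no  _ = v ∷ greedy (spread H p F ∪ ⁅ v ⁆) vs

  greedy-valid : ∀ F vs → ValidFrom H p F (greedy F vs)
  greedy-valid F []       = tt
  greedy-valid F (v ∷ vs) with v Subset.∈? F
  ... | yes _   = greedy-valid F vs
  ... | no  v∉F = v∉F , greedy-valid (spread H p F ∪ ⁅ v ⁆) vs

  greedy-covers : ∀ F vs {x} → x ∈ vs → x ∈ₛ finalFrom H p F (greedy F vs)
  greedy-covers F (v ∷ vs) x∈vs with v Subset.∈? F | x∈vs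
  ... | yes v∈F | here refl = finalFrom-⊇ F (greedy F vs) v∈F
  ... | yes _   | there x∈ = greedy-covers F vs x∈
  ... | no  _   | here refl =
    finalFrom-⊇ _ (greedy _ vs) (Subset.q⊆p∪q (spread H p F) ⁅ v ⁆ (Subset.x∈⁅x⁆ v))
  ... | no  _   | there x∈ = greedy-covers _ vs x∈

  burningSeq-exists : Fin n → ∃ (IsBurningSeq H p)
  burningSeq-exists v = v ∷ greedy ⁅ v ⁆ (allFin n) , greedy-valid ⁅ v ⁆ (allFin n) ,
    Subset.⊆-antisym Subset.⊆⊤ (λ {x} _ → greedy-covers ⁅ v ⁆ (allFin n) (∈-allFin x))

  BurningSeqOfLength : ℕ → Set
  BurningSeqOfLength j = ∃[ us ] length us ≡ j × IsBurningSeq H p us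

  burningNumber-exists : Fin n → ∃ (BurningNumber H p)
  burningNumber-exists v =
    let us , burns = burningSeq-exists v
        j , (us′ , len , burns′) , least = least-witness BurningSeqOfLength? (us , refl , burns)
    in j , (us′ , burns′ , len) , λ vs burns″ → least _ (vs , refl , burns″)
    where
    BurningSeqOfLength? : Decidable BurningSeqOfLength
    BurningSeqOfLength? = any-ofLength? IsBurningSeq?

  spreadIter≡iterate : ∀ t S → spreadIter H p t S ≡ iterate (spread H p) S t
  spreadIter≡iterate zero    S = refl
  spreadIter≡iterate (suc t) S = spreadIter≡iterate t (spread H p S)

  lazy⇒saturates : ∀ {S} → IsLazyBurningSet H p S → spreadIter H p n S ≡ ⊤
  lazy⇒saturates {S} (t , burnt) = trans (spreadIter≡iterate n S)
    (iterate-saturates (spread H p) (spread-⊇ H p) t (trans (sym (spreadIter≡iterate t S)) burnt))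

  SaturatingOfSize : ℕ → Set
  SaturatingOfSize j = ∃[ S ] ∣ S ∣ ≡ j × spreadIter H p n S ≡ ⊤

  lazyBurningNumber-exists : ∃ (LazyBurningNumber H p)
  lazyBurningNumber-exists =
    let j , (S , size , saturates) , least = least-witness SaturatingOfSize? (⊤ , Subset.∣⊤∣≡n n , ⊤-saturates)
    in j , (S , (n , saturates) , size) , λ S′ lazy → least _ (S′ , refl , lazy⇒saturates lazy)
    where
    SaturatingOfSize? : Decidable SaturatingOfSize
    SaturatingOfSize? j = Subset.anySubset? λ S → (∣ S ∣ ℕ.≟ j) ×-dec (spreadIter H p n S ≟ₛ ⊤)
    ⊤-saturates : spreadIter H p n ⊤ ≡ ⊤
    ⊤-saturates = lazy⇒saturates (zero , refl)

-- Burning numbers only depend on the propagation step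

module _ {n} (H : Hypergraph n) {p p′ : ℚ} (same-spread : ∀ F → spread H p F ≡ spread H p′ F) where

  ValidFrom-cong : ∀ F us → ValidFrom H p F us ≡ ValidFrom H p′ F us
  ValidFrom-cong F []       = refl
  ValidFrom-cong F (u ∷ us) = cong (u ∉ₛ F ×_)
    (trans (ValidFrom-cong _ us) (cong (λ G → ValidFrom H p′ (G ∪ ⁅ u ⁆) us) (same-spread F)))

  finalFrom-cong : ∀ F us → finalFrom H p F us ≡ finalFrom H p′ F us
  finalFrom-cong F []       = refl
  finalFrom-cong F (u ∷ us) =
    trans (finalFrom-cong _ us) (cong (λ G → finalFrom H p′ (G ∪ ⁅ u ⁆) us) (same-spread F))

  IsBurningSeq-cong : ∀ us → IsBurningSeq H p us ≡ IsBurningSeq H p′ us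
  IsBurningSeq-cong []       = refl
  IsBurningSeq-cong (u ∷ us) = cong₂ _×_ (ValidFrom-cong ⁅ u ⁆ us) (cong (_≡ ⊤) (finalFrom-cong ⁅ u ⁆ us))

  spreadIter-cong : ∀ t S → spreadIter H p t S ≡ spreadIter H p′ t S
  spreadIter-cong zero    S = refl
  spreadIter-cong (suc t) S = trans (spreadIter-cong t _) (cong (spreadIter H p′ t) (same-spread S))

  BurningNumber-cong : ∀ {j} → BurningNumber H p j → BurningNumber H p′ j
  BurningNumber-cong ((us , burns , len) , least) =
    (us , subst id (IsBurningSeq-cong us) burns , len) ,
    λ vs burns′ → least vs (subst id (sym (IsBurningSeq-cong vs)) burns′)

  LazyBurningNumber-cong : ∀ {j} → LazyBurningNumber H p j → LazyBurningNumber H p′ j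
  LazyBurningNumber-cong ((S , (t , burnt) , size) , least) =
    (S , (t , trans (sym (spreadIter-cong t S)) burnt) , size) ,
    λ S′ (t′ , burnt′) → least S′ (t′ , trans (spreadIter-cong t′ S′) burnt′)

module OnIntervals {n m} (H : Hypergraph n) {ys : Vec ℚ m} (inc : Increasing ys)
  (ys-enumerate : ∀ q → q ∈ Xset H → ∃ λ t → lookup ys t ≡ q) (ys-⊆-Xset : ∀ t → lookup ys t ∈ Xset H) where

  private
    ys-Proportion : ∀ t → Proportion (lookup ys t)
    ys-Proportion t = Xset-Proportion H (ys-⊆-Xset t)

  InInterval-Proportion : ∀ {i p} → InInterval ys i p → Proportion p
  InInterval-Proportion p∈ =
    InIntervalFrom-lower inc (proj₁ ∘ ys-Proportion) p∈ , InIntervalFrom-upper {ys = ys} (proj₂ ∘ ys-Proportion) p∈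

  InInterval-nonempty : ∀ i → ∃ (InInterval ys i)
  InInterval-nonempty =
    InIntervalFrom-nonempty inc (proj₁ ∘ ys-Proportion) (proj₂ ∘ ys-Proportion) (ℚ.positive⁻¹ ℚ.1ℚ)

  InInterval-SameSide : ∀ {i p p′} → InInterval ys i p → InInterval ys i p′ → SameSide (Xset H) p p′
  InInterval-SameSide p∈ p′∈ q q∈X with ys-enumerate q q∈X
  ... | t , refl = ⇔-sym (InIntervalFrom-≤-lookup⇔ inc p′∈ t) ⇔-∘ InIntervalFrom-≤-lookup⇔ inc p∈ t

  spread-constant-on-InInterval : ∀ {i p p′} → InInterval ys i p → InInterval ys i p′ →
    ∀ F → spread H p F ≡ spread H p′ F
  spread-constant-on-InInterval p∈ p′∈ = spread-cong H (InInterval-Proportion p∈) (InInterval-Proportion p′∈)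
    λ e e∈H q q∈ → InInterval-SameSide p∈ p′∈ q (fracsOf-⊆-Xset e∈H q∈)

theorem3p11 : (n : ℕ) (H : Hypergraph (suc n)) (m : ℕ) (ys : Vec ℚ (suc m)) →
    (∀ (i j : Fin (suc m)) → i < j → lookup ys i Data.Rational.< lookup ys j) →
    (∀ (q : ℚ) → (q ∈ Xset H → ∃ λ i → lookup ys i ≡ q) × (∀ i → lookup ys i ≡ q → q ∈ Xset H)) →
    (∀ (i : Fin (suc (suc m))) →
      (∃ λ j → ∀ p → InInterval ys i p → BurningNumber H p j) ×
      (∃ λ j → ∀ p → InInterval ys i p → LazyBurningNumber H p j))
theorem3p11 n H m ys sorted enumerates i =
  (proj₁ b₀ , λ p p∈ → BurningNumber-cong H (same-spread p∈) (proj₂ b₀)) ,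
  (proj₁ l₀ , λ p p∈ → LazyBurningNumber-cong H (same-spread p∈) (proj₂ l₀))
  where
  inc : Increasing ys
  inc = increasing sorted
  ys-enumerate : ∀ q → q ∈ Xset H → ∃ λ t → lookup ys t ≡ q
  ys-enumerate q = proj₁ (enumerates q)
  ys-⊆-Xset : ∀ t → lookup ys t ∈ Xset H
  ys-⊆-Xset t = proj₂ (enumerates (lookup ys t)) t refl
  open OnIntervals H inc ys-enumerate ys-⊆-Xset
  p₀ : ℚ
  p₀ = proj₁ (InInterval-nonempty i)
  same-spread : ∀ {p} → InInterval ys i p → ∀ F → spread H p₀ F ≡ spread H p F
  same-spread = spread-constant-on-InInterval (proj₂ (InInterval-nonempty i))
  b₀ : ∃ (BurningNumber H p₀)
  b₀ = burningNumber-exists H p₀ Fin.zero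
  l₀ : ∃ (LazyBurningNumber H p₀)
  l₀ = lazyBurningNumber-exists H p₀
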